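{- Let $R$ be a tolerance on $U$ induced by an irredundant covering of $U$. Then the set of completely join-irreducible elements of $(\mathit{RS},\le)$ is $$\mathcal{J}(\mathit{RS})=\{(R(x)^{\downarrow},R(x)^{\uparrow})\mid R(x)\text{ is a block}\}\cup\{(\emptyset,R(x))\mid R(x)\text{ is a block and }|R(x)|\ge 2\}.$$
   Context: A tolerance on $U$ is a reflexive symmetric relation; $R(x)=\{y\mid x\,R\,y\}$; $X^{\downarrow}=\{x\mid R(x)\subseteq X\}$, $X^{\uparrow}=\{x\mid R(x)\cap X\neq\emptyset\}$. A block of $R$ is a maximal (w.r.t. inclusion) nonempty $X\subseteq U$ with $X\times X\subseteq R$. A covering is a family of nonempty subsets of $U$ with union $U$, irredundant if no member can be removed keeping a covering; its induced tolerance is $\bigcup\{X\times X\mid X\in\mathcal{H}\}$. $\mathit{RS}=\{(X^{\downarrow},X^{\uparrow})\mid X\subseteq U\}$ ordered coordinatewise (a complete lattice for such $R$). An element $j$ of a complete lattice is completely join-irreducible if $j=\bigvee S$ implies $j\in S$ for every subset $S$ (so the least element is not completely join-irreducible). -}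

module Defs where

open import Data.Empty using (⊥)
open import Data.Product using (Σ; ∃; ∃-syntax; _×_; _,_)
open import Data.Sum using (_⊎_)
open import Relation.Nullary using (¬_)
open import Relation.Binary.PropositionalEquality using (_≡_)

Subset : Set → Set₁
Subset U = U → Set

module _ {U : Set} where

  _⊆_ : Subset U → Subset U → Set
  X ⊆ Y = ∀ x → X x → Y x

  _≐_ : Subset U → Subset U → Set
  X ≐ Y = (X ⊆ Y) × (Y ⊆ X)

  ∅ : Subset U
  ∅ _ = ⊥

  IsCovering : {I : Set} → (I → Subset U) → Set
  IsCovering X = (∀ i → ∃[ x ] X i x) × (∀ u → ∃[ i ] X i u)

  -- Irredundant: for each member X i, the family with X i removed
  -- (i.e. the members extensionally different from X i) is not a covering.
  IsIrredundant : {I : Set} → (I → Subset U) → Set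
  IsIrredundant X = ∀ i → ¬ (∀ u → ∃[ j ] (¬ (X j ≐ X i) × X j u))

  induced : {I : Set} → (I → Subset U) → U → U → Set
  induced X x y = ∃[ i ] (X i x × X i y)

  module Tol (R : U → U → Set) where

    Rset : U → Subset U
    Rset x y = R x y

    _↓ : Subset U → Subset U
    (X ↓) x = ∀ y → R x y → X y

    _↑ : Subset U → Subset U
    (X ↑) x = ∃[ y ] (R x y × X y)

    InRS : Subset U → Subset U → Set₁
    InRS A B = ∃[ X ] ((A ≐ (X ↓)) × (B ≐ (X ↑)))

    _≤RS_ : (Subset U × Subset U) → (Subset U × Subset U) → Set
    (A , B) ≤RS (A' , B') = (A ⊆ A') × (B ⊆ B')

    _∈F_ : (Subset U × Subset U) → (Subset U → Subset U → Set₁) → Set₁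
    (A , B) ∈F S = ∃[ A' ] ∃[ B' ] (S A' B' × (A ≐ A') × (B ≐ B'))

    IsJoinInRS : (Subset U → Subset U → Set₁) → (Subset U × Subset U) → Set₁
    IsJoinInRS S (A , B) =
      InRS A B
      × (∀ A' B' → S A' B' → (A' , B') ≤RS (A , B))
      × (∀ C D → InRS C D → (∀ A' B' → S A' B' → (A' , B') ≤RS (C , D))
                → (A , B) ≤RS (C , D))

    IsCompletelyJoinIrreducible : (Subset U × Subset U) → Set₂
    IsCompletelyJoinIrreducible (A , B) =
      InRS A B
      × (∀ (S : Subset U → Subset U → Set₁) → (∀ A' B' → S A' B' → InRS A' B')
           → IsJoinInRS S (A , B) → (A , B) ∈F S)

    IsBlock : Subset U → Set₁
    IsBlock X = (∃[ x ] X x)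
      × (∀ x y → X x → X y → R x y)
      × (∀ Y → (∀ x y → Y x → Y y → R x y) → X ⊆ Y → Y ⊆ X)

    AtLeastTwo : Subset U → Set
    AtLeastTwo X = ∃[ y ] ∃[ z ] (X y × X z × ¬ (y ≡ z))

    InJ : (Subset U × Subset U) → Set₁
    InJ (A , B) =
      (∃[ x ] (IsBlock (Rset x) × (A ≐ (Rset x ↓)) × (B ≐ (Rset x ↑))))
      ⊎ (∃[ x ] (IsBlock (Rset x) × AtLeastTwo (Rset x)
                 × (A ≐ ∅) × (B ≐ Rset x)))

-- For an irredundant covering, every member is the neighbourhood R(u) of a point u
-- lying in no other member, and hence a block. The pairs listed in 𝒥(RS) are
-- join-dense in RS: a point of X↓ lies in some member K ⊆ X, and a point of X↑ lies
-- in a member K meeting X, which gives (∅ , K) ≤ (X↓ , X↑) when |K| ≥ 2 and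
-- (K↓ , K↑) ≤ (X↓ , X↑) when K is a singleton. So every completely join-irreducible
-- element is listed. Conversely, for each listed j there is a c ∈ RS with j ≰ c lying
-- above every e < j, namely (Z↓ , Z↑) for Z = R(x) ∖ {x} in the first case and
-- (∅ , ∅) in the second; such a j is not the join of elements other than itself.
module Submission where

open import Defs
open import Level using (_⊔_; 0ℓ; suc; Lift; lift; lower)
open import Data.Product using (_×_; _,_; proj₁; proj₂; ∃-syntax)
open import Data.Sum using (inj₁; inj₂)
open import Data.Empty using (⊥-elim)
open import Relation.Nullary using (¬_; yes; no)
open import Relation.Nullary.Decidable using (map′)
open import Relation.Binary.PropositionalEquality using (_≡_; refl; sym; trans; subst)
open import Function.Bundles using (_⇔_; mk⇔)
open import Axiom.ExcludedMiddle using (ExcludedMiddle)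
open import Axiom.DoubleNegationElimination using (DoubleNegationElimination; em⇒dne)

lower-em : ∀ {a} b → ExcludedMiddle (a ⊔ b) → ExcludedMiddle a
lower-em b em {P} = map′ lower lift (em {Lift b P})

module Approximation {U : Set} (R : U → U → Set) where
  open Tol R

  IsClique : Subset U → Set
  IsClique K = ∀ x y → K x → K y → R x y

  ↓-mono : {Y Z : Subset U} → Y ⊆ Z → (Y ↓) ⊆ (Z ↓)
  ↓-mono Y⊆Z x Yx y Rxy = Y⊆Z y (Yx y Rxy)

  ↑-mono : {Y Z : Subset U} → Y ⊆ Z → (Y ↑) ⊆ (Z ↑)
  ↑-mono Y⊆Z x (y , Rxy , Yy) = y , Rxy , Y⊆Z y Yy

  approximations-mono : {Y Z : Subset U} → Y ⊆ Z → ((Y ↓) , (Y ↑)) ≤RS ((Z ↓) , (Z ↑))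
  approximations-mono Y⊆Z = ↓-mono Y⊆Z , ↑-mono Y⊆Z

  cji-if-below-lies-under : DoubleNegationElimination (suc 0ℓ) →
    ∀ {A B C D} → InRS A B → InRS C D → ¬ ((A , B) ≤RS (C , D)) →
    (∀ E F → InRS E F → (E , F) ≤RS (A , B) → ¬ ((A , B) ≤RS (E , F)) →
       (E , F) ≤RS (C , D)) →
    IsCompletelyJoinIrreducible (A , B)
  cji-if-below-lies-under dne {C = C} {D} j∈RS c∈RS j≰c below-j⇒below-c =
    j∈RS , λ S S⊆RS (_ , upper , least) → dne λ j∉S →
      j≰c (least C D c∈RS λ E F e∈S →
        let e≤j = upper E F e∈S in
        below-j⇒below-c E F (S⊆RS E F e∈S) e≤j λ j≤e →
          j∉S (E , F , e∈S , (proj₁ j≤e , proj₁ e≤j) , (proj₂ j≤e , proj₂ e≤j)))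

module Tolerance {U : Set} (R : U → U → Set)
                 (R-refl : ∀ x → R x x) (R-sym : ∀ {x y} → R x y → R y x) where
  open Tol R
  open Approximation R public

  ≐-refl : {Y : Subset U} → Y ≐ Y
  ≐-refl = (λ _ Yy → Yy) , (λ _ Yy → Yy)

  ≐-trans : {X Y Z : Subset U} → X ≐ Y → Y ≐ Z → X ≐ Z
  ≐-trans (X⊆Y , Y⊆X) (Y⊆Z , Z⊆Y) =
    (λ x Xx → Y⊆Z x (X⊆Y x Xx)) , λ x Zx → Y⊆X x (Z⊆Y x Zx)

  ↓-deflationary : (Y : Subset U) → (Y ↓) ⊆ Y
  ↓-deflationary Y x Yx = Yx x (R-refl x)

  ↑-inflationary : (Y : Subset U) → Y ⊆ (Y ↑)
  ↑-inflationary Y x Yx = x , R-refl x , Yx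

  clique-⊆-if-↓-meets : ∀ {K Y a} → IsClique K → (K ↓) a → (Y ↓) a → K ⊆ Y
  clique-⊆-if-↓-meets {K} {a = a} K-clique K↓a Y↓a k Kk =
    Y↓a k (K-clique a k (↓-deflationary K a K↓a) Kk)

  clique-⊆-↑-if-meets : ∀ {K Y y} → IsClique K → (Y ↑) ⊆ K → Y y → K ⊆ (Y ↑)
  clique-⊆-↑-if-meets {Y = Y} {y} K-clique Y↑⊆K Yy k Kk =
    y , K-clique k y Kk (Y↑⊆K y (↑-inflationary Y y Yy)) , Yy

  clique-neighbourhood-isBlock : ∀ x → IsClique (Rset x) → IsBlock (Rset x)
  clique-neighbourhood-isBlock x clique =
    (x , R-refl x) , clique , λ Y Y-clique Rx⊆Y y Yy → Y-clique x y (Rx⊆Y x (R-refl x)) Yy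

  singleton-↓-empty : ∀ {x} → AtLeastTwo (Rset x) → ((_≡ x) ↓) ⊆ ∅
  singleton-↓-empty {x} (a , b , Rxa , Rxb , a≢b) z z-only =
    a≢b (trans (≡x a Rxa) (sym (≡x b Rxb)))
    where
    ≡x : ∀ v → R x v → v ≡ x
    ≡x v Rxv = z-only v (subst (λ t → R t v) (sym (↓-deflationary _ z z-only)) Rxv)

  singleton-↑ : ∀ x → Rset x ≐ ((_≡ x) ↑)
  singleton-↑ x = (λ w Rxw → x , R-sym Rxw , refl) , λ { _ (_ , Rwx , refl) → R-sym Rwx }

  ∅-neighbourhood-∈RS : ∀ {A B x} → AtLeastTwo (Rset x) → A ≐ ∅ → B ≐ Rset x → InRS A B
  ∅-neighbourhood-∈RS {x = x} two (A⊆∅ , _) B≐Rx =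
    (_≡ x)
    , ((λ z Az → ⊥-elim (A⊆∅ z Az)) , λ z z∈↓ → ⊥-elim (singleton-↓-empty two z z∈↓))
    , ≐-trans B≐Rx (singleton-↑ x)

  InJ⇒InRS : ∀ {A B} → InJ (A , B) → InRS A B
  InJ⇒InRS (inj₁ (x , _ , A≐ , B≐)) = Rset x , A≐ , B≐
  InJ⇒InRS (inj₂ (x , _ , two , A≐ , B≐)) = ∅-neighbourhood-∈RS two A≐ B≐

  InJ-resp-≐ : ∀ {A B A' B'} → A ≐ A' → B ≐ B' → InJ (A' , B') → InJ (A , B)
  InJ-resp-≐ A≐ B≐ (inj₁ (x , blk , A'≐ , B'≐)) =
    inj₁ (x , blk , ≐-trans A≐ A'≐ , ≐-trans B≐ B'≐)
  InJ-resp-≐ A≐ B≐ (inj₂ (x , blk , two , A'≐ , B'≐)) =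
    inj₂ (x , blk , two , ≐-trans A≐ A'≐ , ≐-trans B≐ B'≐)

  neighbourhood-approximation-cji : DoubleNegationElimination (suc 0ℓ) →
    ∀ {A B x} → IsClique (Rset x) → A ≐ (Rset x ↓) → B ≐ (Rset x ↑) →
    IsCompletelyJoinIrreducible (A , B)
  neighbourhood-approximation-cji dne {A} {B} {x} K-clique (A⊆ , ⊆A) (B⊆ , ⊆B) =
    cji-if-below-lies-under dne (K , (A⊆ , ⊆A) , (B⊆ , ⊆B)) (Z , ≐-refl , ≐-refl) j≰c below
    where
    K Z : Subset U
    K = Rset x
    Z y = R x y × ¬ (y ≡ x)

    dne₀ : DoubleNegationElimination 0ℓ
    dne₀ ¬¬p = lower (dne λ ¬lp → ¬¬p λ p → ¬lp (lift p))

    j≰c : ¬ ((A , B) ≤RS ((Z ↓) , (Z ↑)))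
    j≰c (A⊆Z↓ , _) = proj₂ (A⊆Z↓ x (⊆A x λ _ Rxy → Rxy) x (R-refl x)) refl

    below : ∀ E F → InRS E F → (E , F) ≤RS (A , B) → ¬ ((A , B) ≤RS (E , F)) →
            (E , F) ≤RS ((Z ↓) , (Z ↑))
    below E F (Y , (E⊆ , ⊆E) , (F⊆ , ⊆F)) (E⊆A , F⊆B) j≰e =
      (λ a Ea → ⊥-elim (Y↓-empty a (E⊆ a Ea))) , F⊆Z↑
      where
      Y↓-empty : ∀ a → ¬ (Y ↓) a
      Y↓-empty a Y↓a = j≰e
        ( (λ z Az → ⊆E z (proj₁ K≤Y z (A⊆ z Az)))
        , (λ w Bw → ⊆F w (proj₂ K≤Y w (B⊆ w Bw))) )
        where
        K⊆Y = clique-⊆-if-↓-meets K-clique (A⊆ a (E⊆A a (⊆E a Y↓a))) Y↓a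
        K≤Y = approximations-mono K⊆Y

      -- If Z↑ missed w, then w ∈ K and every neighbour of w in K would be x,
      -- forcing K = {x} ⊆ Y and so x ∈ Y↓.
      F⊆Z↑ : F ⊆ (Z ↑)
      F⊆Z↑ w Fw = dne₀ λ ¬Z↑w →
        let only-x : ∀ z → R w z → K z → z ≡ x
            only-x z Rwz Kz = dne₀ λ z≢x → ¬Z↑w (z , Rwz , Kz , z≢x)
            (k , Rwk , Kk) = B⊆ w (F⊆B w Fw)
            Kw : K w
            Kw = R-sym (subst (R w) (only-x k Rwk Kk) Rwk)
            K-is-x : ∀ z → K z → z ≡ x
            K-is-x z Kz = only-x z (K-clique w z Kw Kz) Kz
            (y , Rwy , Yy) = F⊆ w Fw
            y≡x = K-is-x y (subst (λ t → R t y) (K-is-x w Kw) Rwy)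
        in Y↓-empty x λ v Rxv → subst Y (trans y≡x (sym (K-is-x v Rxv))) Yy

  ∅-neighbourhood-cji : DoubleNegationElimination (suc 0ℓ) →
    ∀ {A B x} → IsClique (Rset x) → AtLeastTwo (Rset x) → A ≐ ∅ → B ≐ Rset x →
    IsCompletelyJoinIrreducible (A , B)
  ∅-neighbourhood-cji dne {A} {B} {x} K-clique two A≐∅ (B⊆ , ⊆B) =
    cji-if-below-lies-under dne (∅-neighbourhood-∈RS two A≐∅ (B⊆ , ⊆B))
      (∅ , ≐-refl , ≐-refl)
      (λ (_ , B⊆∅↑) → proj₂ (proj₂ (B⊆∅↑ x (⊆B x (R-refl x)))))
      below
    where
    below : ∀ E F → InRS E F → (E , F) ≤RS (A , B) → ¬ ((A , B) ≤RS (E , F)) →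
            (E , F) ≤RS ((∅ ↓) , (∅ ↑))
    below E F (Y , _ , (F⊆ , ⊆F)) (E⊆A , F⊆B) j≰e =
      (λ z Ez → ⊥-elim (proj₁ A≐∅ z (E⊆A z Ez))) , λ w Fw → ⊥-elim (F-empty w Fw)
      where
      Y↑⊆K : (Y ↑) ⊆ Rset x
      Y↑⊆K z Y↑z = B⊆ z (F⊆B z (⊆F z Y↑z))

      F-empty : ∀ w → ¬ F w
      F-empty w Fw =
        j≰e ((λ z Az → ⊥-elim (proj₁ A≐∅ z Az)) , λ b Bb → ⊆F b (K⊆Y↑ b (B⊆ b Bb)))
        where
        K⊆Y↑ = clique-⊆-↑-if-meets K-clique Y↑⊆K (proj₂ (proj₂ (F⊆ w Fw)))

  InJ⇒cji : DoubleNegationElimination (suc 0ℓ) →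
            ∀ {A B} → InJ (A , B) → IsCompletelyJoinIrreducible (A , B)
  InJ⇒cji dne (inj₁ (_ , (_ , clique , _) , A≐ , B≐)) =
    neighbourhood-approximation-cji dne clique A≐ B≐
  InJ⇒cji dne (inj₂ (_ , (_ , clique , _) , two , A≐ , B≐)) =
    ∅-neighbourhood-cji dne clique two A≐ B≐

module IrredundantCovering (em : ExcludedMiddle 0ℓ) {U I : Set} (X : I → Subset U)
                           (covering : IsCovering X) (irredundant : IsIrredundant X) where

  induced-refl : ∀ x → induced X x x
  induced-refl x = let (i , Xix) = proj₂ covering x in i , Xix , Xix

  induced-sym : ∀ {x y} → induced X x y → induced X y x
  induced-sym (i , Xix , Xiy) = i , Xiy , Xix

  open Tol (induced X)
  open Tolerance (induced X) induced-refl induced-sym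

  dne : DoubleNegationElimination 0ℓ
  dne = em⇒dne em

  -- Irredundancy yields a point u covered by no member other than X i; its
  -- neighbourhood is then exactly X i.
  member-is-neighbourhood : ∀ i → ∃[ u ] (Rset u ≐ X i)
  member-is-neighbourhood i with em {∃[ u ] ¬ (∃[ j ] (¬ (X j ≐ X i) × X j u))}
  ... | no no-private-point =
    ⊥-elim (irredundant i λ u → dne λ ¬other → no-private-point (u , ¬other))
  ... | yes (u , ¬other) = u , Ru⊆Xi , Xi⊆Ru
    where
    same-member : ∀ j → X j u → X j ≐ X i
    same-member j Xju = dne λ Xj≠Xi → ¬other (j , Xj≠Xi , Xju)

    Ru⊆Xi : Rset u ⊆ X i
    Ru⊆Xi v (j , Xju , Xjv) = proj₁ (same-member j Xju) v Xjv

    Xi⊆Ru : X i ⊆ Rset u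
    Xi⊆Ru v Xiv =
      let (j , Xju) = proj₂ covering u in i , proj₁ (same-member j Xju) u Xju , Xiv

  member-neighbourhood-isBlock : ∀ {i u} → Rset u ≐ X i → IsBlock (Rset u)
  member-neighbourhood-isBlock {i} {u} (Ru⊆Xi , _) =
    clique-neighbourhood-isBlock u λ a b Rua Rub → i , Ru⊆Xi a Rua , Ru⊆Xi b Rub

  InJ-join-dense : ∀ {A B} → InRS A B →
    IsJoinInRS (λ E F → InJ (E , F) × (E , F) ≤RS (A , B)) (A , B)
  InJ-join-dense {A} {B} (Y , (A⊆ , ⊆A) , (B⊆ , ⊆B)) =
    (Y , (A⊆ , ⊆A) , (B⊆ , ⊆B)) , (λ _ _ → proj₂) , least
    where
    Below : Subset U → Subset U → Set₁
    Below E F = InJ (E , F) × (E , F) ≤RS (A , B)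

    approximations-below : ∀ {u} → IsBlock (Rset u) → Rset u ⊆ Y →
                           Below (Rset u ↓) (Rset u ↑)
    approximations-below {u} block Ru⊆Y =
      inj₁ (u , block , ≐-refl , ≐-refl)
      , (λ z Ru↓z → ⊆A z (proj₁ (approximations-mono Ru⊆Y) z Ru↓z))
      , (λ w Ru↑w → ⊆B w (proj₂ (approximations-mono Ru⊆Y) w Ru↑w))

    least : ∀ C D → InRS C D → (∀ E F → Below E F → (E , F) ≤RS (C , D)) →
            (A , B) ≤RS (C , D)
    least C D (W , (C⊆ , ⊆C) , (D⊆ , ⊆D)) bound = A⊆C , B⊆D
      where
      A⊆C : A ⊆ C
      A⊆C z Az = ⊆C z λ { v (i , Xiz , Xiv) →
        let (u , Ru≐Xi) = member-is-neighbourhood i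
            Ru⊆Y : Rset u ⊆ Y
            Ru⊆Y k Ruk = A⊆ z Az k (i , Xiz , proj₁ Ru≐Xi k Ruk)
            (Ru↓⊆C , _) = bound _ _ (approximations-below (member-neighbourhood-isBlock Ru≐Xi) Ru⊆Y)
        in C⊆ u (Ru↓⊆C u λ _ Ruv → Ruv) v (proj₂ Ru≐Xi v Xiv) }

      B⊆D : B ⊆ D
      B⊆D w Bw with B⊆ w Bw
      ... | y , (i , Xiw , Xiy) , Yy with member-is-neighbourhood i
      ... | u , Ru≐Xi with em {AtLeastTwo (Rset u)}
      ... | yes two = proj₂ (bound _ _ (inJ , (λ _ ()) , Ru⊆B)) w (proj₂ Ru≐Xi w Xiw)
        where
        inJ = inj₂ (u , member-neighbourhood-isBlock Ru≐Xi , two , ≐-refl , ≐-refl)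
        Ru⊆B : Rset u ⊆ B
        Ru⊆B b Rub = ⊆B b (y , (i , proj₁ Ru≐Xi b Rub , Xiy) , Yy)
      ... | no ¬two = Ru↑⊆D w (↑-inflationary _ w (proj₂ Ru≐Xi w Xiw))
        where
        Ruy = proj₂ Ru≐Xi y Xiy
        Ru⊆Y : Rset u ⊆ Y
        Ru⊆Y k Ruk = subst Y (dne λ y≢k → ¬two (y , k , Ruy , Ruk , y≢k)) Yy
        Ru↑⊆D = proj₂ (bound _ _ (approximations-below (member-neighbourhood-isBlock Ru≐Xi) Ru⊆Y))

  cji⇒InJ : ∀ {A B} → IsCompletelyJoinIrreducible (A , B) → InJ (A , B)
  cji⇒InJ (j∈RS , irreducible) =
    let (_ , _ , (j' , _) , A≐ , B≐) =
          irreducible _ (λ _ _ (j , _) → InJ⇒InRS j) (InJ-join-dense j∈RS)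
    in InJ-resp-≐ A≐ B≐ j'

proposition3p6 : ExcludedMiddle (suc (suc 0ℓ)) →
    (U : Set) (I : Set) (X : I → Subset U) → IsCovering X → IsIrredundant X →
    ∀ (A B : Subset U) →
    Tol.IsCompletelyJoinIrreducible (induced X) (A , B)
    ⇔ Tol.InJ (induced X) (A , B)
proposition3p6 em U I X covering irredundant A B =
  mk⇔ cji⇒InJ (InJ⇒cji (em⇒dne (lower-em (suc (suc 0ℓ)) em)))
  where
  open IrredundantCovering (lower-em (suc (suc 0ℓ)) em) X covering irredundant
  open Tolerance (induced X) induced-refl induced-sym
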